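{- Let $q$ be a prime power and $d\leq e$ positive integers, and assume $q\geq 3$, or $q=2$ and $d\neq e$. For $0\leq i,j\leq d$ let $$B_j(i)=\sum_{h=0}^{j}(-1)^{j-h}q^{eh+\binom{j-h}{2}}{d-h \brack d-j}_q{d-i \brack h}_q.$$ Then for every $1\leq j\leq d$, $B_j(d-j+1)\leq B_j(i)$ for all $0\leq i\leq d$; i.e. $B_j(d-j+1)$ is the smallest eigenvalue of the bilinear forms graph $H_q(d,e,j)$.
   Context: For integers $N\geq 0$ and $k$, ${N \brack k}_q=\prod_{t=1}^{k}\frac{q^{N-k+t}-1}{q^t-1}$ if $0\leq k\leq N$, and $0$ if $k<0$ or $k>N$. The graph $H_q(d,e,j)$ has as vertices the $d\times e$ matrices over $\mathbb{F}_q$, two matrices being adjacent iff their difference has rank $j$; its eigenvalues are $B_j(i)$, $0\leq i\leq d$. -}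

module Defs where

open import Data.Nat as ℕ using (ℕ; zero; suc; _+_; _*_; _∸_; _^_; _≤ᵇ_)
open import Data.Nat.DivMod using (_/_)
open import Data.Nat.Primality using (Prime)
open import Data.Nat.Combinatorics using (_C_)
open import Data.Integer as ℤ using (ℤ; +_)
open import Data.List using (List; map; foldr; upTo)
open import Data.Bool using (if_then_else_)
open import Data.Product using (∃₂; _×_)
open import Relation.Binary.PropositionalEquality using (_≡_)

IsPrimePower : ℕ → Set
IsPrimePower q = ∃₂ λ p k → Prime p × q ≡ p ^ suc k

prodFrom1 : ℕ → (ℕ → ℕ) → ℕ
prodFrom1 zero f = 1
prodFrom1 (suc k) f = prodFrom1 k f * f (suc k)

-- exact division (the quotient is an integer); division by 0 never occurs for q ≥ 2
divN : ℕ → ℕ → ℕ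
divN a zero = 0
divN a (suc m) = a / suc m

gauss : ℕ → ℕ → ℕ → ℕ
gauss q N k =
  if k ≤ᵇ N
  then divN (prodFrom1 k (λ t → q ^ (N ∸ k + t) ∸ 1)) (prodFrom1 k (λ t → q ^ t ∸ 1))
  else 0

signPow : ℕ → ℤ
signPow zero = ℤ.+ 1
signPow (suc n) = ℤ.- signPow n

sumℤ : ℕ → (ℕ → ℤ) → ℤ
sumℤ n f = foldr ℤ._+_ (ℤ.+ 0) (map f (upTo (suc n)))

B : (q d e j i : ℕ) → ℤ
B q d e j i = sumℤ j (λ h →
  signPow (j ∸ h) ℤ.* (+ (q ^ (e * h + ((j ∸ h) C 2)) * gauss q (d ∸ h) (d ∸ j) * gauss q (d ∸ i) h)))

-- Put m = d − i and u_h = q^(eh + C(j−h,2)) [d−h, d−j], so that B_j(i) = Σ_{h ≤ j} (−1)^(j−h) u_h [m, h].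
-- The hypothesis on q, in the form (q − 1) q^(e−d) ≥ 2, makes the terms u_h [m, h] increase with h for
-- h ≤ min(m, j). An alternating sum of increasing terms has the sign of its last term, absolute value at
-- most that term, and at least the difference of the last two. Hence B_j(i) ≥ 0 when m ≥ j, while for
-- m < j the sum stops at h = m and |B_j(i)| ≤ u_m. For m = j − 1 the eigenvalue is negative of absolute
-- value at least u_{j−1} − u_{j−2} [j−1, j−2]; every other negative eigenvalue has m ≤ j − 3, so its
-- absolute value is at most u_m ≤ u_{j−3}, and u_{j−3} + u_{j−2} [j−1, j−2] ≤ u_{j−1}.
module Submission where

open import Defs
open import Data.Nat using (ℕ; zero; suc; _+_; _*_; _∸_; _^_; _≤_; _<_; _≤ᵇ_; z≤n; s≤s; pred; >-nonZero; _≤?_; _≟_)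
open import Data.Nat.Properties
open import Data.Nat.DivMod using (m*n/n≡m)
open import Data.Nat.Combinatorics using (_C_; nCk+nC[k+1]≡[n+1]C[k+1]; nC1≡n)
open import Data.Nat.Solver using (module +-*-Solver)
open import Data.Integer as ℤ using (ℤ; +_; -_; 1ℤ; -1ℤ; 0ℤ) renaming (_≤_ to _≤ℤ_)
import Data.Integer.Properties as ℤP
import Data.Integer.Solver as ℤSolver
open import Data.List using (map; foldr; applyUpTo)
open import Data.Bool using (true; false; T)
open import Data.Unit using (tt)
open import Data.Sum using (_⊎_; inj₁; inj₂; map₂)
open import Data.Product using (∃-syntax; _×_; _,_)
open import Function using (_∘_; id)
open import Relation.Nullary using (yes; no; contradiction)
open import Relation.Binary.PropositionalEquality
  using (_≡_; _≢_; refl; sym; trans; cong; cong₂; subst; module ≡-Reasoning)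

open +-*-Solver using (solve; _:=_; _:+_; _:*_; con)

prodFrom1-cong : ∀ k {f g : ℕ → ℕ} → (∀ t → f t ≡ g t) → prodFrom1 k f ≡ prodFrom1 k g
prodFrom1-cong zero    f≗g = refl
prodFrom1-cong (suc k) f≗g = cong₂ _*_ (prodFrom1-cong k f≗g) (f≗g (suc k))

prodFrom1-suc : ∀ k f → prodFrom1 (suc k) f ≡ f 1 * prodFrom1 k (f ∘ suc)
prodFrom1-suc zero    f = *-comm 1 (f 1)
prodFrom1-suc (suc k) f =
  trans (cong (_* f (2 + k)) (prodFrom1-suc k f)) (*-assoc (f 1) _ (f (2 + k)))

cross-≤ : ∀ {a b X Y} c k → 0 < X → a * X ≡ b * Y → c * Y ≤ k * X → c * a ≤ k * b
cross-≤ {a} {b} {X} {Y} c k X>0 aX≡bY cY≤kX = *-cancelʳ-≤ (c * a) (k * b) X {{>-nonZero X>0}} (begin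
    c * a * X    ≡⟨ *-assoc c a X ⟩
    c * (a * X)  ≡⟨ cong (c *_) aX≡bY ⟩
    c * (b * Y)  ≡⟨ solve 3 (λ b c Y → c :* (b :* Y) := b :* (c :* Y)) refl b c Y ⟩
    b * (c * Y)  ≤⟨ *-monoʳ-≤ b cY≤kX ⟩
    b * (k * X)  ≡⟨ solve 3 (λ b k X → b :* (k :* X) := k :* b :* X) refl b k X ⟩
    k * b * X    ∎)
  where open ≤-Reasoning

*-cross-≡ : ∀ {a b c d X Y Z W} → a * X ≡ b * Y → c * Z ≡ d * W → a * c * (X * Z) ≡ b * d * (Y * W)
*-cross-≡ {a} {b} {c} {d} {X} {Y} {Z} {W} aX≡bY cZ≡dW = begin
    a * c * (X * Z)      ≡⟨ solve 4 (λ a c X Z → a :* c :* (X :* Z) := (a :* X) :* (c :* Z)) refl a c X Z ⟩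
    (a * X) * (c * Z)    ≡⟨ cong₂ _*_ aX≡bY cZ≡dW ⟩
    (b * Y) * (d * W)    ≡⟨ solve 4 (λ b d Y W → (b :* Y) :* (d :* W) := b :* d :* (Y :* W)) refl b d Y W ⟩
    b * d * (Y * W)      ∎
  where open ≡-Reasoning

x≤[x∸1]*y : ∀ {x y} → 2 ≤ x → 2 ≤ y → x ≤ (x ∸ 1) * y
x≤[x∸1]*y {suc x} {y} (s≤s 1≤x) 2≤y = begin
    1 + x      ≤⟨ +-monoˡ-≤ x 1≤x ⟩
    x + x      ≡⟨ cong (_+_ x) (sym (+-identityʳ x)) ⟩
    2 * x      ≤⟨ *-monoˡ-≤ x 2≤y ⟩
    y * x      ≡⟨ *-comm y x ⟩
    x * y      ∎
  where open ≤-Reasoning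

3*x≤4*[x∸1] : ∀ {x} → 4 ≤ x → 3 * x ≤ 4 * (x ∸ 1)
3*x≤4*[x∸1] {suc x} (s≤s 3≤x) = subst (_≤ 4 * x) (sym (*-suc 3 x)) (+-monoˡ-≤ (3 * x) 3≤x)

sumℤ-suc : ∀ n f → sumℤ (suc n) f ≡ sumℤ n f ℤ.+ f (suc n)
sumℤ-suc n f = applyUpTo-snoc id (suc n)
  where
  applyUpTo-snoc : ∀ g k → foldr ℤ._+_ 0ℤ (map f (applyUpTo g (suc k)))
                         ≡ foldr ℤ._+_ 0ℤ (map f (applyUpTo g k)) ℤ.+ f (g k)
  applyUpTo-snoc g zero    = ℤP.+-comm (f (g 0)) 0ℤ
  applyUpTo-snoc g (suc k) = trans (cong (ℤ._+_ (f (g 0))) (applyUpTo-snoc (g ∘ suc) k))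
                                   (sym (ℤP.+-assoc (f (g 0)) _ (f (g (suc k)))))

sumℤ-vanishing-tail : ∀ m f → (∀ h → m < h → f h ≡ 0ℤ) → ∀ k → sumℤ (m + k) f ≡ sumℤ m f
sumℤ-vanishing-tail m f f≡0 zero    = cong (λ n → sumℤ n f) (+-identityʳ m)
sumℤ-vanishing-tail m f f≡0 (suc k) = begin
    sumℤ (m + suc k) f                ≡⟨ cong (λ n → sumℤ n f) (+-suc m k) ⟩
    sumℤ (suc (m + k)) f              ≡⟨ sumℤ-suc (m + k) f ⟩
    sumℤ (m + k) f ℤ.+ f (suc (m + k)) ≡⟨ cong₂ ℤ._+_ (sumℤ-vanishing-tail m f f≡0 k) (f≡0 _ (s≤s (m≤m+n m k))) ⟩
    sumℤ m f ℤ.+ 0ℤ                   ≡⟨ ℤP.+-identityʳ (sumℤ m f) ⟩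
    sumℤ m f                          ∎
  where open ≡-Reasoning

signPow≡1⊎-1 : ∀ n → signPow n ≡ 1ℤ ⊎ signPow n ≡ -1ℤ
signPow≡1⊎-1 zero = inj₁ refl
signPow≡1⊎-1 (suc n) with signPow≡1⊎-1 n
... | inj₁ σ≡1  = inj₂ (cong -_ σ≡1)
... | inj₂ σ≡-1 = inj₁ (cong -_ σ≡-1)

-a≤signPow*b : ∀ {a b} n → (signPow n ≡ -1ℤ → b ≤ a) → - + a ≤ℤ signPow n ℤ.* + b
-a≤signPow*b {a} {b} n negative⇒b≤a with signPow n | signPow≡1⊎-1 n
... | _ | inj₁ refl = subst (- + a ≤ℤ_) (sym (ℤP.*-identityˡ (+ b))) ℤP.neg-≤-pos
... | _ | inj₂ refl = subst (- + a ≤ℤ_) (sym (ℤP.-1*i≡-i (+ b))) (ℤP.neg-mono-≤ (ℤ.+≤+ (negative⇒b≤a refl)))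

alternating-sum-of-increasing : ∀ j (t : ℕ → ℕ) n → n ≤ j → (∀ k → k < n → t k ≤ t (suc k)) →
  ∃[ a ] sumℤ n (λ h → signPow (j ∸ h) ℤ.* + t h) ≡ signPow (j ∸ n) ℤ.* + a
       × a ≤ t n × t n ∸ t (pred n) ≤ a
alternating-sum-of-increasing j t zero    _   _    = t 0 , ℤP.+-identityʳ _ , ≤-refl , m∸n≤m (t 0) (t 0)
alternating-sum-of-increasing j t (suc n) n<j mono
  with alternating-sum-of-increasing j t n (<⇒≤ n<j) (λ k k<n → mono k (m<n⇒m<1+n k<n))
... | a , sum≡ , a≤t , _ = t (suc n) ∸ a , sum≡′ , m∸n≤m (t (suc n)) a , ∸-monoʳ-≤ (t (suc n)) a≤t
  where
  open ≡-Reasoning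
  σ : ℤ
  σ = signPow (j ∸ suc n)
  f : ℕ → ℤ
  f h = signPow (j ∸ h) ℤ.* + t h
  a≤t′ : a ≤ t (suc n)
  a≤t′ = ≤-trans a≤t (mono n ≤-refl)
  flip : (- σ) ℤ.* + a ℤ.+ σ ℤ.* + t (suc n) ≡ σ ℤ.* + (t (suc n) ∸ a)
  flip = begin
        (- σ) ℤ.* + a ℤ.+ σ ℤ.* + t (suc n)
      ≡⟨ S.solve 3 (λ σ A T → (S.:- σ) S.:* A S.:+ σ S.:* T S.:= σ S.:* (T S.:- A)) refl σ (+ a) (+ t (suc n)) ⟩
        σ ℤ.* (+ t (suc n) ℤ.- + a)
      ≡⟨ cong (σ ℤ.*_) (trans (ℤP.m-n≡m⊖n (t (suc n)) a) (ℤP.⊖-≥ a≤t′)) ⟩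
        σ ℤ.* + (t (suc n) ∸ a)
      ∎
    where module S = ℤSolver.+-*-Solver
  sum≡′ : sumℤ (suc n) f ≡ σ ℤ.* + (t (suc n) ∸ a)
  sum≡′ = begin
      sumℤ (suc n) f                                  ≡⟨ sumℤ-suc n f ⟩
      sumℤ n f ℤ.+ σ ℤ.* + t (suc n)                  ≡⟨ cong (ℤ._+ σ ℤ.* + t (suc n)) sum≡ ⟩
      signPow (j ∸ n) ℤ.* + a ℤ.+ σ ℤ.* + t (suc n)   ≡⟨ cong (λ x → signPow x ℤ.* + a ℤ.+ f (suc n)) (+-∸-assoc 1 n<j) ⟩
      (- σ) ℤ.* + a ℤ.+ σ ℤ.* + t (suc n)             ≡⟨ flip ⟩
      σ ℤ.* + (t (suc n) ∸ a)                         ∎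

module QBinomial (r : ℕ) where

  q : ℕ
  q = 2 + r

  q^n>0 : ∀ n → 0 < q ^ n
  q^n>0 = m^n>0 q

  q≤q^[1+n] : ∀ n → q ≤ q ^ suc n
  q≤q^[1+n] n = m≤m*n q (q ^ n) {{>-nonZero (q^n>0 n)}}

  q∸1≤q^[1+n]∸1 : ∀ n → q ∸ 1 ≤ q ^ suc n ∸ 1
  q∸1≤q^[1+n]∸1 n = ∸-monoˡ-≤ 1 (q≤q^[1+n] n)

  q^[1+n]∸1>0 : ∀ n → 0 < q ^ suc n ∸ 1
  q^[1+n]∸1>0 n = ≤-trans (s≤s z≤n) (q∸1≤q^[1+n]∸1 n)

  q^n≤q^[1+n]∸1 : ∀ n → q ^ n ≤ q ^ suc n ∸ 1
  q^n≤q^[1+n]∸1 n = subst (q ^ n ≤_) (sym (+-∸-assoc (q ^ n) (≤-trans (q^n>0 n) (m≤m+n _ _))))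
                          (m≤m+n (q ^ n) _)

  4≤q^2 : 4 ≤ q ^ 2
  4≤q^2 = *-mono-≤ {2} {q} {2} 2≤q (subst (2 ≤_) (sym (*-identityʳ q)) 2≤q)
    where
    2≤q : 2 ≤ q
    2≤q = m≤m+n 2 r

  3*q^2≤[q^3∸1]*[q^2∸1] : 3 * q ^ 2 ≤ (q ^ 3 ∸ 1) * (q ^ 2 ∸ 1)
  3*q^2≤[q^3∸1]*[q^2∸1] = subst (_≤ (q ^ 3 ∸ 1) * (q ^ 2 ∸ 1)) (*-comm (q ^ 2) 3)
    (*-mono-≤ (q^n≤q^[1+n]∸1 2) (∸-monoˡ-≤ 1 4≤q^2))

  3*q^2≤2*[q^2∸1]*w : ∀ {w} → 2 ≤ w → 3 * q ^ 2 ≤ 2 * (q ^ 2 ∸ 1) * w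
  3*q^2≤2*[q^2∸1]*w {w} 2≤w = begin
      3 * q ^ 2            ≤⟨ 3*x≤4*[x∸1] 4≤q^2 ⟩
      4 * (q ^ 2 ∸ 1)      ≡⟨ solve 1 (λ x → con 4 :* x := con 2 :* x :* con 2) refl (q ^ 2 ∸ 1) ⟩
      2 * (q ^ 2 ∸ 1) * 2  ≤⟨ *-monoʳ-≤ (2 * (q ^ 2 ∸ 1)) 2≤w ⟩
      2 * (q ^ 2 ∸ 1) * w  ∎
    where open ≤-Reasoning

  2≤[q∸1]*q^f : ∀ f → 3 ≤ q ⊎ 0 < f → 2 ≤ (q ∸ 1) * q ^ f
  2≤[q∸1]*q^f f       (inj₁ (s≤s 2≤q∸1)) = ≤-trans 2≤q∸1 (m≤m*n (q ∸ 1) (q ^ f) {{>-nonZero (q^n>0 f)}})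
  2≤[q∸1]*q^f (suc f) (inj₂ _)          = *-mono-≤ {1} {q ∸ 1} (s≤s z≤n) (≤-trans (m≤m+n 2 r) (q≤q^[1+n] f))

  qFactorial : ℕ → ℕ
  qFactorial k = prodFrom1 k (λ t → q ^ t ∸ 1)

  qFalling : ℕ → ℕ → ℕ
  qFalling n k = prodFrom1 k (λ t → q ^ (n ∸ k + t) ∸ 1)

  qFactorial>0 : ∀ k → 0 < qFactorial k
  qFactorial>0 zero    = ≤-refl
  qFactorial>0 (suc k) = *-mono-≤ (qFactorial>0 k) (q^[1+n]∸1>0 k)

  qFalling-diag : ∀ n → qFalling n n ≡ qFactorial n
  qFalling-diag n = prodFrom1-cong n (λ t → cong (λ x → q ^ (x + t) ∸ 1) (n∸n≡0 n))

  qFalling-suc-suc : ∀ n k → k ≤ n → qFalling (suc n) (suc k) ≡ qFalling n k * (q ^ suc n ∸ 1)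
  qFalling-suc-suc n k k≤n =
    cong (λ x → qFalling n k * (q ^ x ∸ 1)) (trans (+-suc (n ∸ k) k) (cong suc (m∸n+n≡m k≤n)))

  qFalling-suc : ∀ n k → k < n → qFalling n (suc k) ≡ (q ^ (n ∸ k) ∸ 1) * qFalling n k
  qFalling-suc n k k<n = trans (prodFrom1-suc k _)
      (cong₂ _*_ (cong (λ x → q ^ x ∸ 1) (trans (+-comm _ 1) 1+n∸[1+k]≡n∸k))
                 (prodFrom1-cong k (λ t → cong (λ x → q ^ x ∸ 1) (trans (+-suc _ t) (cong (_+ t) 1+n∸[1+k]≡n∸k)))))
    where
    1+n∸[1+k]≡n∸k : suc (n ∸ suc k) ≡ n ∸ k
    1+n∸[1+k]≡n∸k = sym (+-∸-assoc 1 k<n)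

  -- The q-Pascal recursion; it exhibits gauss q n k as an exact quotient.
  qBinomial : ℕ → ℕ → ℕ
  qBinomial n       zero    = 1
  qBinomial zero    (suc k) = 0
  qBinomial (suc n) (suc k) = qBinomial n k + q ^ suc k * qBinomial n (suc k)

  qBinomial-empty : ∀ n k → n < k → qBinomial n k ≡ 0
  qBinomial-empty zero    (suc k) _         = refl
  qBinomial-empty (suc n) (suc k) (s≤s n<k)
    rewrite qBinomial-empty n k n<k | qBinomial-empty n (suc k) (m<n⇒m<1+n n<k) = *-zeroʳ (q ^ suc k)

  qBinomial-diag : ∀ n → qBinomial n n ≡ 1
  qBinomial-diag zero = refl
  qBinomial-diag (suc n)
    rewrite qBinomial-diag n | qBinomial-empty n (suc n) (n<1+n n) | *-zeroʳ (q ^ suc n) = refl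

  qBinomial-*-qFactorial : ∀ n k → k ≤ n → qBinomial n k * qFactorial k ≡ qFalling n k
  qBinomial-*-qFactorial n       zero    _         = refl
  qBinomial-*-qFactorial (suc n) (suc k) (s≤s k≤n) with m≤n⇒m<n∨m≡n k≤n
  ... | inj₂ refl = trans (cong (_* qFactorial (suc k)) (qBinomial-diag (suc k)))
                          (trans (*-identityˡ _) (sym (qFalling-diag (suc k))))
  ... | inj₁ k<n = begin
      (qBinomial n k + A * qBinomial n (suc k)) * (qFactorial k * (A ∸ 1))
        ≡⟨ solve 5 (λ g A h D x → (g :+ A :* h) :* (D :* x) := g :* D :* x :+ A :* (h :* (D :* x)))
                   refl (qBinomial n k) A (qBinomial n (suc k)) (qFactorial k) (A ∸ 1) ⟩
      qBinomial n k * qFactorial k * (A ∸ 1) + A * (qBinomial n (suc k) * qFactorial (suc k))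
        ≡⟨ cong₂ (λ x y → x * (A ∸ 1) + A * y) (qBinomial-*-qFactorial n k k≤n)
                 (trans (qBinomial-*-qFactorial n (suc k) k<n) (qFalling-suc n k k<n)) ⟩
      F * (A ∸ 1) + A * ((A′ ∸ 1) * F)
        ≡⟨ solve 4 (λ F x A y → F :* x :+ A :* (y :* F) := F :* (x :+ A :* y)) refl F (A ∸ 1) A (A′ ∸ 1) ⟩
      F * ((A ∸ 1) + A * (A′ ∸ 1))
        ≡⟨ cong (F *_) (telescope (q^n>0 (suc k)) (q^n>0 (n ∸ k))) ⟩
      F * (A * A′ ∸ 1)
        ≡⟨ cong (λ x → F * (x ∸ 1)) (sym (^-distribˡ-+-* q (suc k) (n ∸ k))) ⟩
      F * (q ^ suc (k + (n ∸ k)) ∸ 1)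
        ≡⟨ cong (λ x → F * (q ^ suc x ∸ 1)) (m+[n∸m]≡n k≤n) ⟩
      F * (q ^ suc n ∸ 1)
        ≡⟨ sym (qFalling-suc-suc n k k≤n) ⟩
      qFalling (suc n) (suc k) ∎
    where
    open ≡-Reasoning
    A A′ F : ℕ
    A = q ^ suc k
    A′ = q ^ (n ∸ k)
    F = qFalling n k
    telescope : ∀ {x y} → 0 < x → 0 < y → (x ∸ 1) + x * (y ∸ 1) ≡ x * y ∸ 1
    telescope {suc x} {suc y} _ _ = solve 2 (λ x y → x :+ (con 1 :+ x) :* y := y :+ x :* (con 1 :+ y)) refl x y

  gauss≡qBinomial : ∀ n k → k ≤ n → gauss q n k ≡ qBinomial n k
  gauss≡qBinomial n k k≤n with k ≤ᵇ n | ≤⇒≤ᵇ k≤n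
  ... | true | _ = trans (cong (λ x → divN x (qFactorial k)) (sym (qBinomial-*-qFactorial n k k≤n)))
                         (exact (qFactorial>0 k))
    where
    exact : ∀ {b} → 0 < b → divN (qBinomial n k * b) b ≡ qBinomial n k
    exact {suc b} _ = m*n/n≡m (qBinomial n k) (suc b)

  gauss-empty : ∀ n k → n < k → gauss q n k ≡ 0
  gauss-empty n k n<k with k ≤ᵇ n in k≤ᵇn
  ... | false = refl
  ... | true  = contradiction (≤ᵇ⇒≤ k n (subst T (sym k≤ᵇn) tt)) (<⇒≱ n<k)

  gauss-diag : ∀ n → gauss q n n ≡ 1
  gauss-diag n = trans (gauss≡qBinomial n n ≤-refl) (qBinomial-diag n)

  gauss-*-qFactorial : ∀ n k → k ≤ n → gauss q n k * qFactorial k ≡ qFalling n k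
  gauss-*-qFactorial n k k≤n = trans (cong (_* qFactorial k) (gauss≡qBinomial n k k≤n)) (qBinomial-*-qFactorial n k k≤n)

  gauss-suc-k : ∀ m k → suc k ≤ m → gauss q m (suc k) * (q ^ suc k ∸ 1) ≡ gauss q m k * (q ^ (m ∸ k) ∸ 1)
  gauss-suc-k m k k<m = *-cancelʳ-≡ _ _ (qFactorial k) {{>-nonZero (qFactorial>0 k)}} (begin
      gauss q m (suc k) * x * qFactorial k   ≡⟨ *-assoc (gauss q m (suc k)) x (qFactorial k) ⟩
      gauss q m (suc k) * (x * qFactorial k) ≡⟨ cong (_*_ (gauss q m (suc k))) (*-comm x (qFactorial k)) ⟩
      gauss q m (suc k) * qFactorial (suc k) ≡⟨ gauss-*-qFactorial m (suc k) k<m ⟩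
      qFalling m (suc k)                     ≡⟨ qFalling-suc m k k<m ⟩
      y * qFalling m k                       ≡⟨ cong (_*_ y) (sym (gauss-*-qFactorial m k (<⇒≤ k<m))) ⟩
      y * (gauss q m k * qFactorial k)       ≡⟨ solve 3 (λ y g D → y :* (g :* D) := g :* y :* D)
                                                  refl y (gauss q m k) (qFactorial k) ⟩
      gauss q m k * y * qFactorial k         ∎)
    where
    open ≡-Reasoning
    x y : ℕ
    x = q ^ suc k ∸ 1
    y = q ^ (m ∸ k) ∸ 1

  gauss-suc-n : ∀ c a → gauss q (c + suc a) c * (q ^ suc a ∸ 1) ≡ gauss q (c + a) c * (q ^ (c + suc a) ∸ 1)
  gauss-suc-n c a rewrite +-suc c a = *-cancelʳ-≡ _ _ (qFactorial c) {{>-nonZero (qFactorial>0 c)}} (begin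
      gauss q (suc N) c * y * qFactorial c       ≡⟨ solve 3 (λ g y D → g :* y :* D := y :* (g :* D))
                                                      refl (gauss q (suc N) c) y (qFactorial c) ⟩
      y * (gauss q (suc N) c * qFactorial c)     ≡⟨ cong (_*_ y) (gauss-*-qFactorial (suc N) c (m≤n⇒m≤1+n c≤N)) ⟩
      y * qFalling (suc N) c                     ≡⟨ cong (λ z → (q ^ z ∸ 1) * qFalling (suc N) c) (sym [1+N]∸c≡1+a) ⟩
      (q ^ (suc N ∸ c) ∸ 1) * qFalling (suc N) c ≡⟨ sym (qFalling-suc (suc N) c (s≤s c≤N)) ⟩
      qFalling (suc N) (suc c)                   ≡⟨ qFalling-suc-suc N c c≤N ⟩
      qFalling N c * x                           ≡⟨ cong (_* x) (sym (gauss-*-qFactorial N c c≤N)) ⟩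
      gauss q N c * qFactorial c * x             ≡⟨ solve 3 (λ g D x → g :* D :* x := g :* x :* D)
                                                      refl (gauss q N c) (qFactorial c) x ⟩
      gauss q N c * x * qFactorial c             ∎)
    where
    open ≡-Reasoning
    N x y : ℕ
    N = c + a
    x = q ^ suc N ∸ 1
    y = q ^ suc a ∸ 1
    c≤N : c ≤ N
    c≤N = m≤m+n c a
    [1+N]∸c≡1+a : suc N ∸ c ≡ suc a
    [1+N]∸c≡1+a = trans (+-∸-assoc 1 c≤N) (cong suc (m+n∸m≡n c a))

  -- coeff e h (j − h) (d − j) is the coefficient q^(eh + C(j−h,2)) [d−h, d−j] of [d−i, h] in B_j(i).
  coeff : ℕ → ℕ → ℕ → ℕ → ℕ
  coeff e h a c = q ^ (e * h + a C 2) * gauss q (c + a) c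

  coeff-ratio : ∀ e k a c → coeff e k (suc a) c * ((q ^ suc a ∸ 1) * q ^ e)
                          ≡ coeff e (suc k) a c * (q ^ a * (q ^ (c + suc a) ∸ 1))
  coeff-ratio e k a c = begin
      P * g′ * (x * q ^ e)     ≡⟨ solve 4 (λ P g x E → P :* g :* (x :* E) := (P :* E) :* (g :* x)) refl P g′ x (q ^ e) ⟩
      (P * q ^ e) * (g′ * x)   ≡⟨ cong₂ _*_ powers (gauss-suc-n c a) ⟩
      (P′ * q ^ a) * (g * y)   ≡⟨ solve 4 (λ P A g y → (P :* A) :* (g :* y) := P :* g :* (A :* y)) refl P′ (q ^ a) g y ⟩
      P′ * g * (q ^ a * y)     ∎
    where
    open ≡-Reasoning
    P P′ g′ g x y : ℕ
    P = q ^ (e * k + suc a C 2)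
    P′ = q ^ (e * suc k + a C 2)
    g′ = gauss q (c + suc a) c
    g = gauss q (c + a) c
    x = q ^ suc a ∸ 1
    y = q ^ (c + suc a) ∸ 1
    [1+a]C2≡a+aC2 : suc a C 2 ≡ a + a C 2
    [1+a]C2≡a+aC2 = trans (sym (nCk+nC[k+1]≡[n+1]C[k+1] a 1)) (cong (_+ a C 2) (nC1≡n a))
    exponents : e * k + suc a C 2 + e ≡ e * suc k + a C 2 + a
    exponents = begin
        e * k + suc a C 2 + e    ≡⟨ cong (λ z → e * k + z + e) [1+a]C2≡a+aC2 ⟩
        e * k + (a + a C 2) + e  ≡⟨ solve 4 (λ e k a b → e :* k :+ (a :+ b) :+ e := e :+ e :* k :+ b :+ a) refl e k a (a C 2) ⟩
        e + e * k + a C 2 + a    ≡⟨ cong (λ z → z + a C 2 + a) (sym (*-suc e k)) ⟩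
        e * suc k + a C 2 + a    ∎
    powers : P * q ^ e ≡ P′ * q ^ a
    powers = trans (sym (^-distribˡ-+-* q (e * k + suc a C 2) e))
                   (trans (cong (q ^_) exponents) (^-distribˡ-+-* q (e * suc k + a C 2) a))

module Eigenvalue (r d e j : ℕ) (j≤d : j ≤ d) (d≤e : d ≤ e)
                  (weight : 2 ≤ suc r * (2 + r) ^ (e ∸ d)) where
  open QBinomial r

  u : ℕ → ℕ
  u h = q ^ (e * h + (j ∸ h) C 2) * gauss q (d ∸ h) (d ∸ j)

  t : ℕ → ℕ → ℕ
  t m h = u h * gauss q m h

  -- eigenvalue m is B_j(d − m).
  eigenvalue : ℕ → ℤ
  eigenvalue m = sumℤ j (λ h → signPow (j ∸ h) ℤ.* + t m h)

  q^e*[q∸1]≡[q∸1]*q^[e∸d]*q^d : q ^ e * (q ∸ 1) ≡ (q ∸ 1) * q ^ (e ∸ d) * q ^ d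
  q^e*[q∸1]≡[q∸1]*q^[e∸d]*q^d = begin
      q ^ e * (q ∸ 1)                    ≡⟨ cong (λ x → q ^ x * (q ∸ 1)) (sym (m+[n∸m]≡n d≤e)) ⟩
      q ^ (d + (e ∸ d)) * (q ∸ 1)        ≡⟨ cong (_* (q ∸ 1)) (^-distribˡ-+-* q d (e ∸ d)) ⟩
      q ^ d * q ^ (e ∸ d) * (q ∸ 1)      ≡⟨ solve 3 (λ D F x → D :* F :* x := x :* F :* D)
                                                  refl (q ^ d) (q ^ (e ∸ d)) (q ∸ 1) ⟩
      (q ∸ 1) * q ^ (e ∸ d) * q ^ d      ∎
    where open ≡-Reasoning

  q^[d∸k]*q^[1+k]≡q^[1+d] : ∀ k → k ≤ d → q ^ (d ∸ k) * q ^ suc k ≡ q ^ suc d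
  q^[d∸k]*q^[1+k]≡q^[1+d] k k≤d =
    trans (sym (^-distribˡ-+-* q (d ∸ k) (suc k))) (cong (q ^_) (trans (+-suc (d ∸ k) k) (cong suc (m∸n+n≡m k≤d))))

  [q^[1+a]∸1]*q^e>0 : ∀ a → 0 < (q ^ suc a ∸ 1) * q ^ e
  [q^[1+a]∸1]*q^e>0 a = *-mono-≤ (q^[1+n]∸1>0 a) (q^n>0 e)

  d∸h≡d∸j+a : ∀ h a → h + a ≡ j → d ∸ h ≡ d ∸ j + a
  d∸h≡d∸j+a h a h+a≡j = trans (cong (_∸ h) d≡d∸j+a+h) (m+n∸n≡m (d ∸ j + a) h)
    where
    d≡d∸j+a+h : d ≡ d ∸ j + a + h
    d≡d∸j+a+h = sym (trans (+-assoc (d ∸ j) a h)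
                           (trans (cong (_+_ (d ∸ j)) (trans (+-comm a h) h+a≡j)) (m∸n+n≡m j≤d)))

  u≡coeff : ∀ h a → h + a ≡ j → u h ≡ coeff e h a (d ∸ j)
  u≡coeff h a h+a≡j = cong₂ (λ x y → q ^ (e * h + x C 2) * gauss q y (d ∸ j))
                            (trans (cong (_∸ h) (sym h+a≡j)) (m+n∸m≡n h a)) (d∸h≡d∸j+a h a h+a≡j)

  u-ratio : ∀ k a → suc k + a ≡ j →
            u k * ((q ^ suc a ∸ 1) * q ^ e) ≡ u (suc k) * (q ^ a * (q ^ (d ∸ k) ∸ 1))
  u-ratio k a 1+k+a≡j = begin
      u k * X                                                 ≡⟨ cong (_* X) (u≡coeff k (suc a) k+1+a≡j) ⟩
      coeff e k (suc a) (d ∸ j) * X                           ≡⟨ coeff-ratio e k a (d ∸ j) ⟩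
      coeff e (suc k) a (d ∸ j) * (q ^ a * (q ^ (d ∸ j + suc a) ∸ 1))
        ≡⟨ cong₂ (λ x y → x * (q ^ a * (q ^ y ∸ 1))) (sym (u≡coeff (suc k) a 1+k+a≡j))
                 (sym (d∸h≡d∸j+a k (suc a) k+1+a≡j)) ⟩
      u (suc k) * (q ^ a * (q ^ (d ∸ k) ∸ 1))                 ∎
    where
    open ≡-Reasoning
    X : ℕ
    X = (q ^ suc a ∸ 1) * q ^ e
    k+1+a≡j : k + suc a ≡ j
    k+1+a≡j = trans (+-suc k a) 1+k+a≡j

  u-mono : ∀ k → suc k ≤ j → u k ≤ u (suc k)
  u-mono k k<j = *-cancelˡ-≤ 1 (cross-≤ {u k} {u (suc k)} {Y = q ^ a * (q ^ (d ∸ k) ∸ 1)} 1 1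
    ([q^[1+a]∸1]*q^e>0 a) (u-ratio k a (m+[n∸m]≡n k<j)) (*-monoʳ-≤ 1 Y≤X))
    where
    a : ℕ
    a = j ∸ suc k
    Y≤X : q ^ a * (q ^ (d ∸ k) ∸ 1) ≤ (q ^ suc a ∸ 1) * q ^ e
    Y≤X = *-mono-≤ (q^n≤q^[1+n]∸1 a) (≤-trans (m∸n≤m _ 1) (^-monoʳ-≤ q (≤-trans (m∸n≤m d k) d≤e)))

  u-increasing : ∀ m n → m ≤ n → n ≤ j → u m ≤ u n
  u-increasing m zero    z≤n _ = ≤-refl
  u-increasing m (suc n) m≤1+n 1+n≤j with m≤n⇒m<n∨m≡n m≤1+n
  ... | inj₂ refl      = ≤-refl
  ... | inj₁ (s≤s m≤n) = ≤-trans (u-increasing m n m≤n (<⇒≤ 1+n≤j)) (u-mono n 1+n≤j)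

  t-mono : ∀ m k → suc k ≤ j → suc k ≤ m → t m k ≤ t m (suc k)
  t-mono m k k<j k<m = *-cancelˡ-≤ 1 (cross-≤ {t m k} {t m (suc k)} {Y = Y * W} 1 1
      (*-mono-≤ ([q^[1+a]∸1]*q^e>0 a) (≤-trans (s≤s z≤n) q∸1≤Z))
      (*-cross-≡ {u k} {u (suc k)} {gauss q m k} {gauss q m (suc k)} {X} {Y} {Z} {W}
                 (u-ratio k a (m+[n∸m]≡n k<j)) (sym (gauss-suc-k m k k<m)))
      (*-monoʳ-≤ 1 YW≤XZ))
    where
    open ≤-Reasoning
    a X Y W Z : ℕ
    a = j ∸ suc k
    X = (q ^ suc a ∸ 1) * q ^ e
    Y = q ^ a * (q ^ (d ∸ k) ∸ 1)
    W = q ^ suc k ∸ 1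
    Z = q ^ (m ∸ k) ∸ 1
    q∸1≤Z : q ∸ 1 ≤ Z
    q∸1≤Z = subst (λ x → q ∸ 1 ≤ q ^ x ∸ 1) (sym (+-∸-assoc 1 k<m)) (q∸1≤q^[1+n]∸1 (m ∸ suc k))
    YW≤XZ : q ^ a * (q ^ (d ∸ k) ∸ 1) * (q ^ suc k ∸ 1) ≤ (q ^ suc a ∸ 1) * q ^ e * Z
    YW≤XZ = begin
        q ^ a * (q ^ (d ∸ k) ∸ 1) * (q ^ suc k ∸ 1)
      ≤⟨ *-mono-≤ (*-monoʳ-≤ (q ^ a) (m∸n≤m _ 1)) (m∸n≤m _ 1) ⟩
        q ^ a * q ^ (d ∸ k) * q ^ suc k
      ≡⟨ trans (*-assoc (q ^ a) _ _) (cong (_*_ (q ^ a)) (q^[d∸k]*q^[1+k]≡q^[1+d] k (≤-trans (<⇒≤ k<j) j≤d))) ⟩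
        q ^ a * q ^ suc d
      ≡⟨ solve 3 (λ q A D → A :* (q :* D) := q :* A :* D) refl q (q ^ a) (q ^ d) ⟩
        q ^ suc a * q ^ d
      ≤⟨ *-monoˡ-≤ (q ^ d) (x≤[x∸1]*y (≤-trans (m≤m+n 2 r) (q≤q^[1+n] a)) weight) ⟩
        (q ^ suc a ∸ 1) * ((q ∸ 1) * q ^ (e ∸ d)) * q ^ d
      ≡⟨ *-assoc (q ^ suc a ∸ 1) _ (q ^ d) ⟩
        (q ^ suc a ∸ 1) * ((q ∸ 1) * q ^ (e ∸ d) * q ^ d)
      ≡⟨ cong (_*_ (q ^ suc a ∸ 1)) (sym q^e*[q∸1]≡[q∸1]*q^[e∸d]*q^d) ⟩
        (q ^ suc a ∸ 1) * (q ^ e * (q ∸ 1))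
      ≡⟨ sym (*-assoc (q ^ suc a ∸ 1) (q ^ e) (q ∸ 1)) ⟩
        (q ^ suc a ∸ 1) * q ^ e * (q ∸ 1)
      ≤⟨ *-monoʳ-≤ ((q ^ suc a ∸ 1) * q ^ e) q∸1≤Z ⟩
        (q ^ suc a ∸ 1) * q ^ e * Z
      ∎

  -- Split as 3 u_s ≤ u_{s+2} and 3 u_{s+1} [s+2, s+1] ≤ 2 u_{s+2}, each read off the ratios u_{h+1}/u_h.
  u-gap : ∀ s → 3 + s ≡ j → u s + t (2 + s) (1 + s) ≤ u (2 + s)
  u-gap s 3+s≡j = *-cancelˡ-≤ 3 (begin
      3 * (u s + V * g)        ≡⟨ *-distribˡ-+ 3 (u s) (V * g) ⟩
      3 * u s + 3 * (V * g)    ≤⟨ +-mono-≤ 3*u[s]≤u[2+s] 3*t≤2*u[2+s] ⟩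
      1 * U + 2 * U            ≡⟨ solve 1 (λ U → con 1 :* U :+ con 2 :* U := con 3 :* U) refl U ⟩
      3 * U                    ∎)
    where
    open ≤-Reasoning
    V U g X₂ X₃ Y₂ Y₃ P : ℕ
    V = u (1 + s)
    U = u (2 + s)
    g = gauss q (2 + s) (1 + s)
    X₂ = (q ^ 2 ∸ 1) * q ^ e
    X₃ = (q ^ 3 ∸ 1) * q ^ e
    Y₂ = q ^ 1 * (q ^ (d ∸ suc s) ∸ 1)
    Y₃ = q ^ 2 * (q ^ (d ∸ s) ∸ 1)
    P = q ^ (2 + s) ∸ 1
    1+s<d : suc s < d
    1+s<d = ≤-trans (n≤1+n _) (≤-trans (≤-reflexive 3+s≡j) j≤d)
    V*X₂≡U*Y₂ : V * X₂ ≡ U * Y₂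
    V*X₂≡U*Y₂ = u-ratio (1 + s) 1 (trans (+-comm (2 + s) 1) 3+s≡j)
    u[s]*X₃≡V*Y₃ : u s * X₃ ≡ V * Y₃
    u[s]*X₃≡V*Y₃ = u-ratio s 2 (trans (+-comm (1 + s) 2) 3+s≡j)
    P≡g*[q∸1] : P ≡ g * (q ∸ 1)
    P≡g*[q∸1] = begin-equality
        P                                    ≡⟨ sym (*-identityˡ P) ⟩
        1 * P                                ≡⟨ cong (_* P) (sym (gauss-diag (2 + s))) ⟩
        gauss q (2 + s) (2 + s) * P          ≡⟨ gauss-suc-k (2 + s) (1 + s) ≤-refl ⟩
        g * (q ^ (2 + s ∸ (1 + s)) ∸ 1)      ≡⟨ cong (λ x → g * (q ^ x ∸ 1)) (m+n∸n≡m 1 s) ⟩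
        g * (q ^ 1 ∸ 1)                      ≡⟨ cong (λ x → g * (x ∸ 1)) (*-identityʳ q) ⟩
        g * (q ∸ 1)                          ∎
    3*t≤2*u[2+s] : 3 * (V * g) ≤ 2 * U
    3*t≤2*u[2+s] = cross-≤ {V * g} {U} {Y = Y₂ * P} 3 2 (*-mono-≤ ([q^[1+a]∸1]*q^e>0 1) (s≤s z≤n))
      (begin-equality
        V * g * (X₂ * (q ∸ 1))     ≡⟨ solve 4 (λ V g X x → V :* g :* (X :* x) := (V :* X) :* (g :* x))
                                              refl V g X₂ (q ∸ 1) ⟩
        (V * X₂) * (g * (q ∸ 1))   ≡⟨ cong₂ _*_ V*X₂≡U*Y₂ (sym P≡g*[q∸1]) ⟩
        (U * Y₂) * P               ≡⟨ *-assoc U Y₂ P ⟩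
        U * (Y₂ * P)               ∎)
      (begin
        3 * (Y₂ * P)
      ≤⟨ *-monoʳ-≤ 3 (*-mono-≤ (*-monoʳ-≤ (q ^ 1) (m∸n≤m (q ^ (d ∸ suc s)) 1)) (m∸n≤m (q ^ (2 + s)) 1)) ⟩
        3 * (q ^ 1 * q ^ (d ∸ suc s) * q ^ (2 + s))
      ≡⟨ cong (_*_ 3) (trans (*-assoc (q ^ 1) (q ^ (d ∸ suc s)) (q ^ (2 + s)))
                             (cong (_*_ (q ^ 1)) (q^[d∸k]*q^[1+k]≡q^[1+d] (suc s) (<⇒≤ 1+s<d)))) ⟩
        3 * (q ^ 1 * q ^ suc d)
      ≡⟨ solve 2 (λ q D → con 3 :* ((q :* con 1) :* (q :* D)) := con 3 :* (q :* (q :* con 1)) :* D) refl q (q ^ d) ⟩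
        3 * q ^ 2 * q ^ d
      ≤⟨ *-monoˡ-≤ (q ^ d) (3*q^2≤2*[q^2∸1]*w weight) ⟩
        2 * (q ^ 2 ∸ 1) * ((q ∸ 1) * q ^ (e ∸ d)) * q ^ d
      ≡⟨ solve 3 (λ x w D → con 2 :* x :* w :* D := con 2 :* (x :* (w :* D)))
                 refl (q ^ 2 ∸ 1) ((q ∸ 1) * q ^ (e ∸ d)) (q ^ d) ⟩
        2 * ((q ^ 2 ∸ 1) * ((q ∸ 1) * q ^ (e ∸ d) * q ^ d))
      ≡⟨ cong (λ x → 2 * ((q ^ 2 ∸ 1) * x)) (sym q^e*[q∸1]≡[q∸1]*q^[e∸d]*q^d) ⟩
        2 * ((q ^ 2 ∸ 1) * (q ^ e * (q ∸ 1)))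
      ≡⟨ cong (_*_ 2) (sym (*-assoc (q ^ 2 ∸ 1) (q ^ e) (q ∸ 1))) ⟩
        2 * (X₂ * (q ∸ 1))
      ∎)
    q^1*q^[d∸[1+s]]≡q^[d∸s] : q ^ 1 * q ^ (d ∸ suc s) ≡ q ^ (d ∸ s)
    q^1*q^[d∸[1+s]]≡q^[d∸s] = trans (sym (^-distribˡ-+-* q 1 (d ∸ suc s))) (cong (q ^_) (sym (+-∸-assoc 1 (<⇒≤ 1+s<d))))
    q^[d∸s]≤q^e : q ^ (d ∸ s) ≤ q ^ e
    q^[d∸s]≤q^e = ^-monoʳ-≤ q (≤-trans (m∸n≤m d s) d≤e)
    3*u[s]≤u[2+s] : 3 * u s ≤ 1 * U
    3*u[s]≤u[2+s] = cross-≤ {u s} {U} {Y = Y₃ * Y₂} 3 1 (*-mono-≤ ([q^[1+a]∸1]*q^e>0 2) ([q^[1+a]∸1]*q^e>0 1))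
      (begin-equality
        u s * (X₃ * X₂)   ≡⟨ sym (*-assoc (u s) X₃ X₂) ⟩
        u s * X₃ * X₂     ≡⟨ cong (_* X₂) u[s]*X₃≡V*Y₃ ⟩
        V * Y₃ * X₂       ≡⟨ solve 3 (λ V Y X → V :* Y :* X := Y :* (V :* X)) refl V Y₃ X₂ ⟩
        Y₃ * (V * X₂)     ≡⟨ cong (_*_ Y₃) V*X₂≡U*Y₂ ⟩
        Y₃ * (U * Y₂)     ≡⟨ solve 3 (λ Y U Y′ → Y :* (U :* Y′) := U :* (Y :* Y′)) refl Y₃ U Y₂ ⟩
        U * (Y₃ * Y₂)     ∎)
      (begin
        3 * (Y₃ * Y₂)
      ≤⟨ *-monoʳ-≤ 3 (*-mono-≤ (*-monoʳ-≤ (q ^ 2) (m∸n≤m (q ^ (d ∸ s)) 1))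
                               (*-monoʳ-≤ (q ^ 1) (m∸n≤m (q ^ (d ∸ suc s)) 1))) ⟩
        3 * (q ^ 2 * q ^ (d ∸ s) * (q ^ 1 * q ^ (d ∸ suc s)))
      ≡⟨ cong (λ x → 3 * (q ^ 2 * q ^ (d ∸ s) * x)) q^1*q^[d∸[1+s]]≡q^[d∸s] ⟩
        3 * (q ^ 2 * q ^ (d ∸ s) * q ^ (d ∸ s))
      ≡⟨ solve 2 (λ Q A → con 3 :* (Q :* A :* A) := con 3 :* Q :* A :* A) refl (q ^ 2) (q ^ (d ∸ s)) ⟩
        3 * q ^ 2 * q ^ (d ∸ s) * q ^ (d ∸ s)
      ≤⟨ *-mono-≤ (*-mono-≤ 3*q^2≤[q^3∸1]*[q^2∸1] q^[d∸s]≤q^e) q^[d∸s]≤q^e ⟩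
        (q ^ 3 ∸ 1) * (q ^ 2 ∸ 1) * q ^ e * q ^ e
      ≡⟨ solve 3 (λ a b E → a :* b :* E :* E := con 1 :* (a :* E :* (b :* E))) refl (q ^ 3 ∸ 1) (q ^ 2 ∸ 1) (q ^ e) ⟩
        1 * (X₃ * X₂)
      ∎)

  t[m,m]≡u[m] : ∀ m → t m m ≡ u m
  t[m,m]≡u[m] m = trans (cong (_*_ (u m)) (gauss-diag m)) (*-identityʳ (u m))

  eigenvalue-nonneg : ∀ m → j ≤ m → 0ℤ ≤ℤ eigenvalue m
  eigenvalue-nonneg m j≤m
    with alternating-sum-of-increasing j (t m) j ≤-refl (λ k k<j → t-mono m k k<j (≤-trans k<j j≤m))
  ... | a , sum≡ , _ = subst (0ℤ ≤ℤ_) (sym eigenvalue≡a) (ℤ.+≤+ z≤n)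
    where
    eigenvalue≡a : eigenvalue m ≡ + a
    eigenvalue≡a = trans sum≡ (trans (cong (λ x → signPow x ℤ.* + a) (n∸n≡0 j)) (ℤP.*-identityˡ (+ a)))

  eigenvalue-below : ∀ m → m < j →
    ∃[ a ] eigenvalue m ≡ signPow (j ∸ m) ℤ.* + a × a ≤ u m × u m ∸ t m (pred m) ≤ a
  eigenvalue-below m m<j
    with alternating-sum-of-increasing j (t m) m (<⇒≤ m<j) (λ k k<m → t-mono m k (<-trans k<m m<j) k<m)
  ... | a , sum≡ , a≤t , t∸t≤a =
    a , trans truncate sum≡ , subst (a ≤_) (t[m,m]≡u[m] m) a≤t
      , subst (λ x → x ∸ t m (pred m) ≤ a) (t[m,m]≡u[m] m) t∸t≤a
    where
    f : ℕ → ℤ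
    f h = signPow (j ∸ h) ℤ.* + t m h
    vanish : ∀ h → m < h → f h ≡ 0ℤ
    vanish h m<h = trans (cong (λ x → signPow (j ∸ h) ℤ.* + (u h * x)) (gauss-empty m h m<h))
                         (trans (cong (λ x → signPow (j ∸ h) ℤ.* + x) (*-zeroʳ (u h))) (ℤP.*-zeroʳ (signPow (j ∸ h))))
    truncate : eigenvalue m ≡ sumℤ m f
    truncate = trans (cong (λ n → sumℤ n f) (sym (m+[n∸m]≡n (<⇒≤ m<j)))) (sumℤ-vanishing-tail m f vanish (j ∸ m))

  u-gap-bound : ∀ j′ → suc j′ ≡ j → ∀ m → 3 + m ≤ j → u m ≤ u j′ ∸ t j′ (pred j′)
  u-gap-bound 0 1≡j m 3+m≤j = contradiction (≤-trans 3+m≤j (≤-reflexive (sym 1≡j))) λ { (s≤s ()) }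
  u-gap-bound 1 2≡j m 3+m≤j = contradiction (≤-trans 3+m≤j (≤-reflexive (sym 2≡j))) λ { (s≤s (s≤s ())) }
  u-gap-bound (suc (suc s)) 3+s≡j m 3+m≤j =
    ≤-trans (u-increasing m s m≤s (≤-trans (m≤n+m s 3) (≤-reflexive 3+s≡j))) (m+n≤o⇒m≤o∸n (u s) (u-gap s 3+s≡j))
    where
    m≤s : m ≤ s
    m≤s = +-cancelˡ-≤ 3 m s (≤-trans 3+m≤j (≤-reflexive (sym 3+s≡j)))

  module _ (j′ : ℕ) (1+j′≡j : suc j′ ≡ j) where

    gap : ℕ
    gap = u j′ ∸ t j′ (pred j′)

    eigenvalue[j′]≤-gap : eigenvalue j′ ≤ℤ - + gap
    eigenvalue[j′]≤-gap =
      let a , eigenvalue≡ , _ , gap≤a = eigenvalue-below j′ (≤-reflexive 1+j′≡j)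
          eigenvalue≡-a : eigenvalue j′ ≡ - + a
          eigenvalue≡-a = trans eigenvalue≡ (trans (cong (λ x → signPow x ℤ.* + a) j∸j′≡1) (ℤP.-1*i≡-i (+ a)))
      in subst (_≤ℤ - + gap) (sym eigenvalue≡-a) (ℤP.neg-mono-≤ (ℤ.+≤+ gap≤a))
      where
      j∸j′≡1 : j ∸ j′ ≡ 1
      j∸j′≡1 = trans (cong (_∸ j′) (sym 1+j′≡j)) (m+n∸n≡m 1 j′)

    negative⇒3+m≤j : ∀ m → m < j → m ≢ j′ → signPow (j ∸ m) ≡ -1ℤ → 3 + m ≤ j
    negative⇒3+m≤j m m<j m≢j′ σ≡-1 with j ∸ m in j∸m≡
    negative⇒3+m≤j m m<j m≢j′ () | 0
    ... | 1 = contradiction (suc-injective (trans 1+j′≡j j≡1+m)) (m≢j′ ∘ sym)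
      where
      j≡1+m : j ≡ suc m
      j≡1+m = trans (sym (m∸n+n≡m (<⇒≤ m<j))) (cong (_+ m) j∸m≡)
    negative⇒3+m≤j m m<j m≢j′ () | 2
    ... | suc (suc (suc n)) = ≤-trans (+-monoˡ-≤ m (m≤m+n 3 n)) (≤-reflexive j∸m+m≡j)
      where
      j∸m+m≡j : 3 + n + m ≡ j
      j∸m+m≡j = trans (cong (_+ m) (sym j∸m≡)) (m∸n+n≡m (<⇒≤ m<j))

    -gap≤eigenvalue : ∀ m → m ≢ j′ → - + gap ≤ℤ eigenvalue m
    -gap≤eigenvalue m m≢j′ with j ≤? m
    ... | yes j≤m = ℤP.≤-trans ℤP.neg-≤-pos (eigenvalue-nonneg m j≤m)
    ... | no  j≰m =
      let m<j = ≰⇒> j≰m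
          a , eigenvalue≡ , a≤u , _ = eigenvalue-below m m<j
      in subst (- + gap ≤ℤ_) (sym eigenvalue≡) (-a≤signPow*b (j ∸ m)
           (λ negative → ≤-trans a≤u (u-gap-bound j′ 1+j′≡j m (negative⇒3+m≤j m m<j m≢j′ negative))))

    eigenvalue-minimum : ∀ m → eigenvalue j′ ≤ℤ eigenvalue m
    eigenvalue-minimum m with m ≟ j′
    ... | yes refl = ℤP.≤-refl
    ... | no m≢j′ = ℤP.≤-trans eigenvalue[j′]≤-gap (-gap≤eigenvalue m m≢j′)

theorem4p7 : (q d e : ℕ) → IsPrimePower q → 1 ≤ d → d ≤ e →
    (3 ≤ q ⊎ (q ≡ 2 × d ≢ e)) →
    (j : ℕ) → 1 ≤ j → j ≤ d → (i : ℕ) → i ≤ d →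
    B q d e j (d ∸ j + 1) ≤ℤ B q d e j i
theorem4p7 0 _ _ _ _ _ (inj₁ ())       _ _ _ _ _
theorem4p7 0 _ _ _ _ _ (inj₂ (() , _)) _ _ _ _ _
theorem4p7 1 _ _ _ _ _ (inj₁ (s≤s ())) _ _ _ _ _
theorem4p7 1 _ _ _ _ _ (inj₂ (() , _)) _ _ _ _ _
theorem4p7 (suc (suc r)) d e _ _ d≤e q-condition (suc j′) _ j≤d i _ =
  subst (λ m → eigenvalue m ≤ℤ eigenvalue (d ∸ i)) (sym d∸[d∸j+1]≡j′) (eigenvalue-minimum j′ refl (d ∸ i))
  where
  weight : 2 ≤ suc r * (2 + r) ^ (e ∸ d)
  weight = QBinomial.2≤[q∸1]*q^f r (e ∸ d) (map₂ (λ (_ , d≢e) → m<n⇒0<n∸m (≤∧≢⇒< d≤e d≢e)) q-condition)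
  open Eigenvalue r d e (suc j′) j≤d d≤e weight
  d∸[d∸j+1]≡j′ : d ∸ (d ∸ suc j′ + 1) ≡ j′
  d∸[d∸j+1]≡j′ = trans (cong (_∸ (d ∸ suc j′ + 1)) (sym (m∸n+n≡m j≤d)))
                       ([m+n]∸[m+o]≡n∸o (d ∸ suc j′) (suc j′) 1)
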